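{- Let $T$ be a tree of order $n\ge 5$. Then $PC(T)=n-2$ if and only if either $T\cong S_{1,p}$ for some $p\ge 1$, or $T$ is obtained from a double star $S_{p,q}$, for some $p\ge 1$ and $q\ge 1$, by subdividing the edge joining its two support vertices.
   Context: The double star $S_{p,q}$ is the tree consisting of two adjacent vertices (support vertices) with $p$ leaves attached to one and $q$ leaves attached to the other. A paired dominating set of $G$ is a dominating set $S$ such that $G[S]$ has a perfect matching. Two disjoint sets form a paired coalition if neither is a paired dominating set but their union is. A $pc$-partition of $G$ is a partition of $V(G)$ into nonempty sets, none a paired dominating set, each forming a paired coalition with some other set of the partition. $PC(G)$ is the maximum number of sets in a $pc$-partition of $G$ ($0$ if none exists). -}

module Defs where

open import Data.Nat using (ℕ; zero; suc; _+_; _≤_; _≡ᵇ_; _<ᵇ_; _≤ᵇ_)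
open import Data.Bool using (Bool; true; false; _∧_; _∨_)
open import Data.Fin using (Fin; toℕ)
open import Data.List using (List; []; _∷_; length; _∷ʳ_)
open import Data.List.Relation.Unary.Unique.Propositional using (Unique)
open import Data.List.Relation.Unary.Linked using (Linked)
open import Data.Product using (Σ; ∃; ∃-syntax; _×_)
open import Data.Sum using (_⊎_)
open import Data.Empty using (⊥)
open import Relation.Nullary using (¬_)
open import Relation.Binary.PropositionalEquality using (_≡_; _≢_)
open import Function.Bundles using (_↔_; Inverse)

Graph : ℕ → Set
Graph n = Fin n → Fin n → Bool

module _ {n : ℕ} (G : Graph n) where

  Adj : Fin n → Fin n → Set
  Adj u v = G u v ≡ true

  IsSimple : Set
  IsSimple = (∀ u v → G u v ≡ G v u) × (∀ v → G v v ≡ false)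

  data Walk : Fin n → Fin n → Set where
    here : ∀ {v} → Walk v v
    step : ∀ {u w v} → Adj u w → Walk w v → Walk u v

  Connected : Set
  Connected = ∀ u v → Walk u v

  IsCycle : List (Fin n) → Set
  IsCycle [] = ⊥
  IsCycle (x ∷ xs) = (2 ≤ length xs) × Unique (x ∷ xs) × Linked Adj ((x ∷ xs) ∷ʳ x)

  Acyclic : Set
  Acyclic = ∀ (c : List (Fin n)) → ¬ IsCycle c

  IsTree : Set
  IsTree = IsSimple × Connected × Acyclic

  VSet : Set₁
  VSet = Fin n → Set

  Dominating : VSet → Set
  Dominating S = ∀ v → S v ⊎ (∃[ u ] (S u × Adj u v))

  -- G[S] has a perfect matching: an involution pairing each vertex of S
  -- with an adjacent vertex of S
  HasPerfectMatching : VSet → Set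
  HasPerfectMatching S =
    Σ (Fin n → Fin n) λ m → ∀ v → S v → S (m v) × Adj v (m v) × m (m v) ≡ v

  PairedDominating : VSet → Set
  PairedDominating S = Dominating S × HasPerfectMatching S

  -- a pc-partition with k (nonempty) classes, given by class-assignment f
  IsPCPartition : (k : ℕ) → (Fin n → Fin k) → Set
  IsPCPartition k f =
    (∀ i → ∃[ v ] (f v ≡ i))
    × (∀ i → ¬ PairedDominating (λ v → f v ≡ i))
    × (∀ i → ∃[ j ] (i ≢ j × PairedDominating (λ v → f v ≡ i ⊎ f v ≡ j)))

  HasPCPartition : ℕ → Set
  HasPCPartition k = Σ (Fin n → Fin k) (IsPCPartition k)

  -- PC(G) = m : m is the maximum order of a pc-partition, or 0 if none exists
  PCis : ℕ → Set
  PCis m = (m ≡ 0 × (∀ k → ¬ HasPCPartition k))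
         ⊎ (HasPCPartition m × (∀ k → HasPCPartition k → k ≤ m))

_≅_ : ∀ {n m} → Graph n → Graph m → Set
_≅_ {n} {m} G H = Σ (Fin n ↔ Fin m) λ σ →
  ∀ u v → G u v ≡ H (Inverse.to σ u) (Inverse.to σ v)

symGraph : ∀ {n} → (ℕ → ℕ → Bool) → Graph n
symGraph e u v = e (toℕ u) (toℕ v) ∨ e (toℕ v) (toℕ u)

-- double star S_{p,q}: vertex 0 = support a, 1 = support b,
-- 2..p+1 leaves of a, p+2..p+q+1 leaves of b
dsEdge : ℕ → ℕ → ℕ → ℕ → Bool
dsEdge p q i j = ((i ≡ᵇ 0) ∧ (j ≡ᵇ 1))
               ∨ ((i ≡ᵇ 0) ∧ (2 ≤ᵇ j) ∧ (j <ᵇ 2 + p))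
               ∨ ((i ≡ᵇ 1) ∧ (2 + p ≤ᵇ j) ∧ (j <ᵇ 2 + p + q))

DoubleStar : (p q : ℕ) → Graph (2 + p + q)
DoubleStar p q = symGraph (dsEdge p q)

-- S_{p,q} with the edge between supports subdivided: 0 = a, 1 = b, 2 = new vertex c,
-- 3..p+2 leaves of a, p+3..p+q+2 leaves of b
sdEdge : ℕ → ℕ → ℕ → ℕ → Bool
sdEdge p q i j = ((i ≡ᵇ 0) ∧ (j ≡ᵇ 2))
               ∨ ((i ≡ᵇ 1) ∧ (j ≡ᵇ 2))
               ∨ ((i ≡ᵇ 0) ∧ (3 ≤ᵇ j) ∧ (j <ᵇ 3 + p))
               ∨ ((i ≡ᵇ 1) ∧ (3 + p ≤ᵇ j) ∧ (j <ᵇ 3 + p + q))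

SubdividedDoubleStar : (p q : ℕ) → Graph (3 + p + q)
SubdividedDoubleStar p q = symGraph (sdEdge p q)

{-# OPTIONS --safe #-}
module Submission where

-- Fix a pc-partition of order n − 2 of a tree and choose a representative in every class. Exactly two
-- vertices r₁, r₂ are not representatives, so the classes are two pairs or one triple X, plus singletons.
-- In a tree a dominating edge meets every edge, and three vertices have no perfect matching. Hence two
-- pairs are impossible: a singleton must be partnered with a singleton, giving a dominating edge, and the
-- two pairs with each other, giving an edge that avoids it. For a triple X, the partner of X yields an
-- edge inside X, so a singleton {u} outside X is not partnered with a singleton and {u} ∪ X has a perfect
-- matching. As the tree is connected and has no short cycles, this forces X to be a path a – c – b with
-- every other vertex a leaf of a or of b, at least one of b: S_{p,q} with its central edge subdivided,
-- where p = 0 gives S_{1,q}. Conversely, in such a tree X and the singletons form a pc-partition; order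
-- n − 1 is impossible in any graph (a pair plus a singleton), and order n would put every vertex on a
-- dominating edge, which a leaf of b is not.

open import Defs
open import Data.Bool using (Bool; true; false; not; _∨_; if_then_else_)
import Data.Bool as Bool
open import Data.Bool.Properties using (∨-comm; ¬-not; not-¬)
open import Data.Empty using (⊥; ⊥-elim)
open import Data.Fin using (Fin; zero; suc; toℕ; splitAt; join; _↑ˡ_; _↑ʳ_)
open import Data.Fin.Permutation using (↔⇒≡)
open import Data.Fin.Properties
  using (_≟_; any?; injective⇒≤; suc-injective; toℕ<n; toℕ-↑ˡ; toℕ-↑ʳ; splitAt-↑ˡ; splitAt-↑ʳ; join-splitAt)
open import Data.List using (List; []; _∷_; length; filter; allFin)
import Data.List as List
open import Data.List.Membership.Propositional using (_∈_)
open import Data.List.Membership.Propositional.Properties using (∈-filter⁺; ∈-filter⁻; ∈-allFin; ∈-lookup)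
open import Data.List.Relation.Unary.All using (All; []; _∷_)
import Data.List.Relation.Unary.All as All
open import Data.List.Relation.Unary.AllPairs using ([]; _∷_)
open import Data.List.Relation.Unary.Any using (here; there)
import Data.List.Relation.Unary.Any as Any
open import Data.List.Relation.Unary.Any.Properties using (lookup-index)
open import Data.List.Relation.Unary.Linked using ([-]; _∷_)
open import Data.List.Relation.Unary.Unique.Propositional using (Unique)
open import Data.List.Relation.Unary.Unique.Propositional.Properties using (filter⁺; allFin⁺)
open import Data.Nat using (ℕ; zero; suc; _+_; _∸_; _≤_; z≤n; s≤s; _<ᵇ_)
open import Data.Nat.Properties using (∸-monoˡ-≤; ≤-trans; 1+n≰n; m+n≤o⇒n≤o)
open import Data.Product using (∃; ∃-syntax; _×_; _,_; proj₁; proj₂; map₂)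
open import Data.Sum using (_⊎_; inj₁; inj₂; [_,_]′)
import Data.Sum as Sum
import Data.Vec.Functional as Vector
open import Function.Base using (_∘_)
open import Function.Bundles using (_⇔_; mk⇔; Inverse; mk↔ₛ′)
open import Function.Construct.Composition using (_↔-∘_)
open import Function.Construct.Symmetry using (↔-sym)
open import Function.Definitions using (Injective)
open import Relation.Binary.PropositionalEquality
open import Relation.Nullary using (¬_; Dec; yes; no; does)
open import Relation.Nullary.Decidable using (dec-true; dec-false; decidable-stable; ¬?; _×-dec_)

-- Paired domination in simple graphs and trees

module _ {n : ℕ} (G : Graph n) where

  IsPerfectMatching : VSet G → (Fin n → Fin n) → Set
  IsPerfectMatching S m = ∀ v → S v → S (m v) × Adj G v (m v) × m (m v) ≡ v

  DominatingEdge : Fin n → Fin n → Set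
  DominatingEdge u w = Dominating G (λ v → v ≡ u ⊎ v ≡ w) × Adj G u w

  Outside : Fin n → Fin n → Fin n → Fin n → Set
  Outside x₁ x₂ x₃ u = u ≢ x₁ × u ≢ x₂ × u ≢ x₃

  -- The perfect matchings of {u, x₁, x₂, x₃}, named by the partner of u.
  data Matching₄ (u x₁ x₂ x₃ : Fin n) : Set where
    u∼x₁ : Adj G u x₁ → Adj G x₂ x₃ → Matching₄ u x₁ x₂ x₃
    u∼x₂ : Adj G u x₂ → Adj G x₁ x₃ → Matching₄ u x₁ x₂ x₃
    u∼x₃ : Adj G u x₃ → Adj G x₁ x₂ → Matching₄ u x₁ x₂ x₃

PairedDominating-resp : ∀ {n} {G : Graph n} {S S′ : VSet G} → (∀ v → S v → S′ v) → (∀ v → S′ v → S v) →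
                        PairedDominating G S → PairedDominating G S′
PairedDominating-resp S⊆S′ S′⊆S (dom , m , pm) =
  (λ v → Sum.map (S⊆S′ v) (λ (u , Su , u∼v) → u , S⊆S′ u Su , u∼v) (dom v)) ,
  m , λ v S′v → let (Smv , v∼mv , mmv≡v) = pm v (S′⊆S v S′v) in S⊆S′ _ Smv , v∼mv , mmv≡v

PairedDominating-∪-comm : ∀ {n} {G : Graph n} {A B : VSet G} →
                         PairedDominating G (λ v → A v ⊎ B v) → PairedDominating G (λ v → B v ⊎ A v)
PairedDominating-∪-comm = PairedDominating-resp (λ _ → Sum.swap) (λ _ → Sum.swap)

module SimpleGraph {n : ℕ} {G : Graph n} (simple : IsSimple G) where

  Adj-sym : ∀ {u v} → Adj G u v → Adj G v u
  Adj-sym {u} {v} = trans (proj₁ simple v u)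

  Adj-irrefl : ∀ {u v} → Adj G u v → u ≢ v
  Adj-irrefl {u} u∼u refl with () ← trans (sym u∼u) (proj₂ simple u)

  singleton-¬PM : ∀ {S x} → S x → (∀ v → S v → v ≡ x) → ¬ HasPerfectMatching G S
  singleton-¬PM Sx only (m , pm) = Adj-irrefl x∼mx (sym (only _ Smx))
    where
      Smx = proj₁ (pm _ Sx)
      x∼mx = proj₁ (proj₂ (pm _ Sx))

  private
    third-unmatched : ∀ {S m x y z} → IsPerfectMatching G S m → x ≢ z → y ≢ z → S x → S z →
                      (∀ v → S v → v ≡ x ⊎ v ≡ y ⊎ v ≡ z) → m x ≡ y → ⊥
    third-unmatched {m = m} {x} {y} {z} pm x≢z y≢z Sx Sz only mx≡y with pm z Sz
    ... | Smz , z∼mz , mmz≡z with only (m z) Smz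
    ... | inj₁ mz≡x = y≢z (begin
      y           ≡⟨ sym mx≡y ⟩
      m x         ≡⟨ cong m (sym mz≡x) ⟩
      m (m z)     ≡⟨ mmz≡z ⟩
      z           ∎) where open ≡-Reasoning
    ... | inj₂ (inj₁ mz≡y) = x≢z (begin
      x           ≡⟨ sym (proj₂ (proj₂ (pm x Sx))) ⟩
      m (m x)     ≡⟨ cong m (trans mx≡y (sym mz≡y)) ⟩
      m (m z)     ≡⟨ mmz≡z ⟩
      z           ∎) where open ≡-Reasoning
    ... | inj₂ (inj₂ mz≡z) = Adj-irrefl z∼mz (sym mz≡z)

    exchange : {A B C : Set} → A ⊎ B ⊎ C → B ⊎ A ⊎ C
    exchange (inj₁ a) = inj₂ (inj₁ a)
    exchange (inj₂ (inj₁ b)) = inj₁ b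
    exchange (inj₂ (inj₂ c)) = inj₂ (inj₂ c)

    swap₂₃ : {A B C D : Set} → A ⊎ B ⊎ C ⊎ D → A ⊎ C ⊎ B ⊎ D
    swap₂₃ = Sum.map₂ exchange

    rotate₂₃₄ : {A B C D : Set} → A ⊎ B ⊎ C ⊎ D → A ⊎ D ⊎ B ⊎ C
    rotate₂₃₄ = Sum.map₂ (exchange ∘ Sum.map₂ Sum.swap)

  triple-¬PM : ∀ {S x y z} → x ≢ y → x ≢ z → y ≢ z → S x → S y → S z →
               (∀ v → S v → v ≡ x ⊎ v ≡ y ⊎ v ≡ z) → ¬ HasPerfectMatching G S
  triple-¬PM x≢y x≢z y≢z Sx Sy Sz only (m , pm) with pm _ Sx
  ... | Smx , x∼mx , _ with only (m _) Smx
  ... | inj₁ mx≡x = Adj-irrefl x∼mx (sym mx≡x)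
  ... | inj₂ (inj₁ mx≡y) = third-unmatched pm x≢z y≢z Sx Sz only mx≡y
  ... | inj₂ (inj₂ mx≡z) =
        third-unmatched pm x≢y (≢-sym y≢z) Sx Sy (λ v Sv → Sum.map₂ Sum.swap (only v Sv)) mx≡z

  two-edges-PM : ∀ {S p q r s} → q ≢ p → r ≢ p → r ≢ q → s ≢ p → s ≢ q → s ≢ r →
                 Adj G p q → Adj G r s → S p → S q → S r → S s →
                 (∀ v → S v → v ≡ p ⊎ v ≡ q ⊎ v ≡ r ⊎ v ≡ s) → HasPerfectMatching G S
  two-edges-PM {S} {p} {q} {r} {s} q≢p r≢p r≢q s≢p s≢q s≢r p∼q r∼s Sp Sq Sr Ss only = m , pm
    where
      m : Fin n → Fin n
      m v with does (v ≟ p) | does (v ≟ q) | does (v ≟ r)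
      ... | true  | _     | _     = q
      ... | false | true  | _     = p
      ... | false | false | true  = s
      ... | false | false | false = r
      m-p : m p ≡ q
      m-p rewrite dec-true (p ≟ p) refl = refl
      m-q : m q ≡ p
      m-q rewrite dec-false (q ≟ p) q≢p | dec-true (q ≟ q) refl = refl
      m-r : m r ≡ s
      m-r rewrite dec-false (r ≟ p) r≢p | dec-false (r ≟ q) r≢q | dec-true (r ≟ r) refl = refl
      m-s : m s ≡ r
      m-s rewrite dec-false (s ≟ p) s≢p | dec-false (s ≟ q) s≢q | dec-false (s ≟ r) s≢r = refl
      pm : IsPerfectMatching G S m
      pm v Sv with only v Sv
      ... | inj₁ refl rewrite m-p = Sq , p∼q , m-q
      ... | inj₂ (inj₁ refl) rewrite m-q = Sp , Adj-sym p∼q , m-p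
      ... | inj₂ (inj₂ (inj₁ refl)) rewrite m-r = Ss , r∼s , m-s
      ... | inj₂ (inj₂ (inj₂ refl)) rewrite m-s = Sr , Adj-sym r∼s , m-r

  pair-PD⇒DominatingEdge : ∀ {S u w} → PairedDominating G S → S u → S w → (∀ v → S v → v ≡ u ⊎ v ≡ w) →
                           DominatingEdge G u w
  pair-PD⇒DominatingEdge {S} {u} {w} (dom , m , pm) Su Sw only = dominating , u∼w
    where
      dominating : Dominating G (λ v → v ≡ u ⊎ v ≡ w)
      dominating v = Sum.map (only v) (λ (x , Sx , x∼v) → x , only x Sx , x∼v) (dom v)
      u∼w : Adj G u w
      u∼w with pm u Su
      ... | Smu , u∼mu , _ with only (m u) Smu
      ... | inj₁ mu≡u = ⊥-elim (Adj-irrefl u∼mu (sym mu≡u))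
      ... | inj₂ mu≡w = subst (Adj G u) mu≡w u∼mu

  private
    remaining-pair-adjacent : ∀ {S m u a b c} → IsPerfectMatching G S m → a ≢ b → b ≢ u → S u → S b →
                      (∀ v → S v → v ≡ u ⊎ v ≡ a ⊎ v ≡ b ⊎ v ≡ c) → m u ≡ a → Adj G b c
    remaining-pair-adjacent {m = m} {u} {a} {b} pm a≢b b≢u Su Sb only mu≡a with pm b Sb
    ... | Smb , b∼mb , mmb≡b with only (m b) Smb
    ... | inj₁ mb≡u = ⊥-elim (a≢b (begin
      a           ≡⟨ sym mu≡a ⟩
      m u         ≡⟨ cong m (sym mb≡u) ⟩
      m (m b)     ≡⟨ mmb≡b ⟩
      b           ∎))
      where open ≡-Reasoning
    ... | inj₂ (inj₁ mb≡a) = ⊥-elim (b≢u (begin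
      b           ≡⟨ sym mmb≡b ⟩
      m (m b)     ≡⟨ cong m (trans mb≡a (sym mu≡a)) ⟩
      m (m u)     ≡⟨ proj₂ (proj₂ (pm u Su)) ⟩
      u           ∎))
      where open ≡-Reasoning
    ... | inj₂ (inj₂ (inj₁ mb≡b)) = ⊥-elim (Adj-irrefl b∼mb (sym mb≡b))
    ... | inj₂ (inj₂ (inj₂ mb≡c)) = subst (Adj G b) mb≡c b∼mb

  HasPM⇒Matching₄ : ∀ {S u x₁ x₂ x₃} → x₁ ≢ x₂ → x₁ ≢ x₃ → Outside G x₁ x₂ x₃ u →
                    S u → S x₁ → S x₂ → (∀ v → S v → v ≡ u ⊎ v ≡ x₁ ⊎ v ≡ x₂ ⊎ v ≡ x₃) →
                    HasPerfectMatching G S → Matching₄ G u x₁ x₂ x₃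
  HasPM⇒Matching₄ x₁≢x₂ x₁≢x₃ (u≢x₁ , u≢x₂ , _) Su Sx₁ Sx₂ only (m , pm) with pm _ Su
  ... | Smu , u∼mu , _ with only (m _) Smu
  ... | inj₁ mu≡u = ⊥-elim (Adj-irrefl u∼mu (sym mu≡u))
  ... | inj₂ (inj₁ mu≡x₁) =
        u∼x₁ (subst (Adj G _) mu≡x₁ u∼mu) (remaining-pair-adjacent pm x₁≢x₂ (≢-sym u≢x₂) Su Sx₂ only mu≡x₁)
  ... | inj₂ (inj₂ (inj₁ mu≡x₂)) =
        u∼x₂ (subst (Adj G _) mu≡x₂ u∼mu)
             (remaining-pair-adjacent pm (≢-sym x₁≢x₂) (≢-sym u≢x₁) Su Sx₁ (λ v → swap₂₃ ∘ only v) mu≡x₂)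
  ... | inj₂ (inj₂ (inj₂ mu≡x₃)) =
        u∼x₃ (subst (Adj G _) mu≡x₃ u∼mu)
             (remaining-pair-adjacent pm (≢-sym x₁≢x₃) (≢-sym u≢x₁) Su Sx₁ (λ v → rotate₂₃₄ ∘ only v) mu≡x₃)

  Matching₄⇒HasPM : ∀ {S u x₁ x₂ x₃} → x₁ ≢ x₂ → x₁ ≢ x₃ → x₂ ≢ x₃ → Outside G x₁ x₂ x₃ u →
                    S u → S x₁ → S x₂ → S x₃ → (∀ v → S v → v ≡ u ⊎ v ≡ x₁ ⊎ v ≡ x₂ ⊎ v ≡ x₃) →
                    Matching₄ G u x₁ x₂ x₃ → HasPerfectMatching G S
  Matching₄⇒HasPM x₁≢x₂ x₁≢x₃ x₂≢x₃ (u≢x₁ , u≢x₂ , u≢x₃) Su Sx₁ Sx₂ Sx₃ only (u∼x₁ u∼x x₂∼x₃) =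
    two-edges-PM (≢-sym u≢x₁) (≢-sym u≢x₂) (≢-sym x₁≢x₂) (≢-sym u≢x₃) (≢-sym x₁≢x₃) (≢-sym x₂≢x₃)
                 u∼x x₂∼x₃ Su Sx₁ Sx₂ Sx₃ only
  Matching₄⇒HasPM x₁≢x₂ x₁≢x₃ x₂≢x₃ (u≢x₁ , u≢x₂ , u≢x₃) Su Sx₁ Sx₂ Sx₃ only (u∼x₂ u∼x x₁∼x₃) =
    two-edges-PM (≢-sym u≢x₂) (≢-sym u≢x₁) x₁≢x₂ (≢-sym u≢x₃) (≢-sym x₂≢x₃) (≢-sym x₁≢x₃)
                 u∼x x₁∼x₃ Su Sx₂ Sx₁ Sx₃ (λ v → swap₂₃ ∘ only v)
  Matching₄⇒HasPM x₁≢x₂ x₁≢x₃ x₂≢x₃ (u≢x₁ , u≢x₂ , u≢x₃) Su Sx₁ Sx₂ Sx₃ only (u∼x₃ u∼x x₁∼x₂) =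
    two-edges-PM (≢-sym u≢x₃) (≢-sym u≢x₁) x₁≢x₃ (≢-sym u≢x₂) x₂≢x₃ (≢-sym x₁≢x₂)
                 u∼x x₁∼x₂ Su Sx₃ Sx₁ Sx₂ (λ v → rotate₂₃₄ ∘ only v)

module Forest {n : ℕ} {G : Graph n} (simple : IsSimple G) (acyclic : Acyclic G) where
  open SimpleGraph simple

  no-triangle : ∀ {a b c} → Adj G a b → Adj G b c → Adj G c a → ⊥
  no-triangle a∼b b∼c c∼a =
    acyclic (_ ∷ _ ∷ _ ∷ [])
      ( s≤s (s≤s z≤n)
      , (Adj-irrefl a∼b ∷ ≢-sym (Adj-irrefl c∼a) ∷ []) ∷ (Adj-irrefl b∼c ∷ []) ∷ [] ∷ []
      , a∼b ∷ b∼c ∷ c∼a ∷ [-])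

  no-square : ∀ {a b c d} → a ≢ c → b ≢ d → Adj G a b → Adj G b c → Adj G c d → Adj G d a → ⊥
  no-square a≢c b≢d a∼b b∼c c∼d d∼a =
    acyclic (_ ∷ _ ∷ _ ∷ _ ∷ [])
      ( s≤s (s≤s z≤n)
      , (Adj-irrefl a∼b ∷ a≢c ∷ ≢-sym (Adj-irrefl d∼a) ∷ []) ∷ (Adj-irrefl b∼c ∷ b≢d ∷ [])
        ∷ (Adj-irrefl c∼d ∷ []) ∷ [] ∷ []
      , a∼b ∷ b∼c ∷ c∼d ∷ d∼a ∷ [-])

  no-pentagon : ∀ {a b c d e} → a ≢ c → a ≢ d → b ≢ d → b ≢ e → c ≢ e →
                Adj G a b → Adj G b c → Adj G c d → Adj G d e → Adj G e a → ⊥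
  no-pentagon a≢c a≢d b≢d b≢e c≢e a∼b b∼c c∼d d∼e e∼a =
    acyclic (_ ∷ _ ∷ _ ∷ _ ∷ _ ∷ [])
      ( s≤s (s≤s z≤n)
      , (Adj-irrefl a∼b ∷ a≢c ∷ a≢d ∷ ≢-sym (Adj-irrefl e∼a) ∷ []) ∷ (Adj-irrefl b∼c ∷ b≢d ∷ b≢e ∷ [])
        ∷ (Adj-irrefl c∼d ∷ c≢e ∷ []) ∷ (Adj-irrefl d∼e ∷ []) ∷ [] ∷ []
      , a∼b ∷ b∼c ∷ c∼d ∷ d∼e ∷ e∼a ∷ [-])

  no-edge-avoids-DominatingEdge : ∀ {s w p q} → DominatingEdge G s w → Adj G p q →
                                  p ≢ s → p ≢ w → q ≢ s → q ≢ w → ⊥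
  no-edge-avoids-DominatingEdge (dom , s∼w) p∼q p≢s p≢w q≢s q≢w with dom _ | dom _
  ... | inj₁ (inj₁ p≡s) | _ = p≢s p≡s
  ... | inj₁ (inj₂ p≡w) | _ = p≢w p≡w
  ... | inj₂ _ | inj₁ (inj₁ q≡s) = q≢s q≡s
  ... | inj₂ _ | inj₁ (inj₂ q≡w) = q≢w q≡w
  ... | inj₂ (_ , inj₁ refl , s∼p) | inj₂ (_ , inj₁ refl , s∼q) = no-triangle p∼q (Adj-sym s∼q) s∼p
  ... | inj₂ (_ , inj₁ refl , s∼p) | inj₂ (_ , inj₂ refl , w∼q) =
        no-square p≢w q≢s p∼q (Adj-sym w∼q) (Adj-sym s∼w) s∼p
  ... | inj₂ (_ , inj₂ refl , w∼p) | inj₂ (_ , inj₁ refl , s∼q) =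
        no-square p≢s q≢w p∼q (Adj-sym s∼q) s∼w w∼p
  ... | inj₂ (_ , inj₂ refl , w∼p) | inj₂ (_ , inj₂ refl , w∼q) = no-triangle p∼q (Adj-sym w∼q) w∼p

  DominatingEdge-¬Matching₄ : ∀ {u w s x₁ x₂ x₃} → DominatingEdge G u w →
                              Outside G x₁ x₂ x₃ u → Outside G x₁ x₂ x₃ w → ¬ Matching₄ G s x₁ x₂ x₃
  DominatingEdge-¬Matching₄ uw (_ , u≢x₂ , u≢x₃) (_ , w≢x₂ , w≢x₃) (u∼x₁ _ x₂∼x₃) =
    no-edge-avoids-DominatingEdge uw x₂∼x₃ (≢-sym u≢x₂) (≢-sym w≢x₂) (≢-sym u≢x₃) (≢-sym w≢x₃)
  DominatingEdge-¬Matching₄ uw (u≢x₁ , _ , u≢x₃) (w≢x₁ , _ , w≢x₃) (u∼x₂ _ x₁∼x₃) =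
    no-edge-avoids-DominatingEdge uw x₁∼x₃ (≢-sym u≢x₁) (≢-sym w≢x₁) (≢-sym u≢x₃) (≢-sym w≢x₃)
  DominatingEdge-¬Matching₄ uw (u≢x₁ , u≢x₂ , _) (w≢x₁ , w≢x₂ , _) (u∼x₃ _ x₁∼x₂) =
    no-edge-avoids-DominatingEdge uw x₁∼x₂ (≢-sym u≢x₁) (≢-sym w≢x₁) (≢-sym u≢x₂) (≢-sym w≢x₂)

boundary-edge : ∀ {n} {G : Graph n} {C : Fin n → Set} → (∀ u → Dec (C u)) →
                ∀ {x y} → C x → ¬ C y → Walk G x y → ∃[ u ] ∃[ v ] (C u × ¬ C v × Adj G u v)
boundary-edge C? Cx ¬Cy here = ⊥-elim (¬Cy Cx)
boundary-edge C? {x} Cx ¬Cy (step {w = w} x∼w walk) with C? w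
... | yes Cw = boundary-edge C? Cw ¬Cy walk
... | no ¬Cw = x , w , Cx , ¬Cw , x∼w

-- Invariance under isomorphism

≅-sym : ∀ {n m} {G : Graph n} {H : Graph m} → G ≅ H → H ≅ G
≅-sym {G = G} {H} (σ , σ-adj) = ↔-sym σ , λ u v → sym (begin
  G (from u) (from v)               ≡⟨ σ-adj (from u) (from v) ⟩
  H (to (from u)) (to (from v))     ≡⟨ cong₂ H (strictlyInverseˡ u) (strictlyInverseˡ v) ⟩
  H u v                             ∎)
  where open Inverse σ
        open ≡-Reasoning

≅-trans : ∀ {n m l} {G : Graph n} {H : Graph m} {K : Graph l} → G ≅ H → H ≅ K → G ≅ K
≅-trans (σ , σ-adj) (τ , τ-adj) = τ ↔-∘ σ , λ u v → trans (σ-adj u v) (τ-adj _ _)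

module _ {n m} {G : Graph n} {H : Graph m} (G≅H : G ≅ H) where
  open Inverse (proj₁ G≅H)

  private
    to-adj : ∀ u v → G u v ≡ H (to u) (to v)
    to-adj = proj₂ G≅H

  PairedDominating-pullback : ∀ {S : VSet H} → PairedDominating H S → PairedDominating G (S ∘ to)
  PairedDominating-pullback {S} (dom , m , pm) = dominating , from ∘ m ∘ to , perfect
    where
      dominating : Dominating G (S ∘ to)
      dominating v with dom (to v)
      ... | inj₁ S[to-v] = inj₁ S[to-v]
      ... | inj₂ (y , Sy , y∼to-v) =
            inj₂ (from y , subst S (sym (strictlyInverseˡ y)) Sy ,
                  trans (to-adj (from y) v) (trans (cong (λ t → H t (to v)) (strictlyInverseˡ y)) y∼to-v))
      perfect : IsPerfectMatching G (S ∘ to) (from ∘ m ∘ to)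
      perfect v S[to-v] with pm (to v) S[to-v]
      ... | Sm , to-v∼m , mm≡to-v =
            subst S (sym (strictlyInverseˡ _)) Sm ,
            trans (to-adj v _) (trans (cong (H (to v)) (strictlyInverseˡ _)) to-v∼m) ,
            trans (cong (from ∘ m) (strictlyInverseˡ _)) (trans (cong from mm≡to-v) (strictlyInverseʳ v))

HasPCPartition-pullback : ∀ {n m k} {G : Graph n} {H : Graph m} → G ≅ H →
                          HasPCPartition H k → HasPCPartition G k
HasPCPartition-pullback {G = G} {H} G≅H (f , surjective , ¬PD , partner) =
  f ∘ to , surjective′ , ¬PD′ , partner′
  where
    open Inverse (proj₁ G≅H)
    surjective′ : ∀ i → ∃[ v ] (f (to v) ≡ i)
    surjective′ i with surjective i
    ... | y , fy≡i = from y , trans (cong f (strictlyInverseˡ y)) fy≡i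
    ¬PD′ : ∀ i → ¬ PairedDominating G (λ v → f (to v) ≡ i)
    ¬PD′ i PD = ¬PD i (PairedDominating-resp (λ y → trans (cong f (sym (strictlyInverseˡ y))))
                                             (λ y → trans (cong f (strictlyInverseˡ y)))
                                             (PairedDominating-pullback (≅-sym G≅H) PD))
    partner′ : ∀ i → ∃[ j ] (i ≢ j × PairedDominating G (λ v → f (to v) ≡ i ⊎ f (to v) ≡ j))
    partner′ i with partner i
    ... | j , i≢j , PD = j , i≢j , PairedDominating-pullback G≅H PD

PCis-pullback : ∀ {n m k} {G : Graph n} {H : Graph m} → G ≅ H → PCis H k → PCis G k
PCis-pullback G≅H (inj₁ (k≡0 , none)) = inj₁ (k≡0 , λ k′ P → none k′ (HasPCPartition-pullback (≅-sym G≅H) P))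
PCis-pullback G≅H (inj₂ (P , maximal)) =
  inj₂ (HasPCPartition-pullback G≅H P , λ k′ P′ → maximal k′ (HasPCPartition-pullback (≅-sym G≅H) P′))

-- Classes of a partition

-- The representatives are in bijection with the k classes, so n − k vertices are not representatives;
-- the bounds below on their number come from injections.
module Representatives {n k : ℕ} (f : Fin n → Fin k) (surjective : ∀ i → ∃[ v ] (f v ≡ i)) where

  rep : Fin k → Fin n
  rep i = proj₁ (surjective i)

  f-rep : ∀ i → f (rep i) ≡ i
  f-rep i = proj₂ (surjective i)

  rep-injective : Injective _≡_ _≡_ rep
  rep-injective {i} {j} rep-i≡rep-j = trans (sym (f-rep i)) (trans (cong f rep-i≡rep-j) (f-rep j))

  IsRep : Fin n → Set
  IsRep v = rep (f v) ≡ v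

  IsRep? : ∀ v → Dec (IsRep v)
  IsRep? v = rep (f v) ≟ v

  rep≢nonRep : ∀ {r} → ¬ IsRep r → ∀ i → rep i ≢ r
  rep≢nonRep ¬rep i refl = ¬rep (cong rep (f-rep i))

  IsRep⇒≡rep : ∀ {v i} → IsRep v → f v ≡ i → v ≡ rep i
  IsRep⇒≡rep rep-v refl = sym rep-v

  IsSingleton : Fin k → Set
  IsSingleton i = ∀ v → f v ≡ i → v ≡ rep i

  allRep⇒≤ : (∀ v → IsRep v) → n ≤ k
  allRep⇒≤ reps = injective⇒≤ {f = f} λ {v} {w} fv≡fw → trans (IsRep⇒≡rep (reps v) fv≡fw) (reps w)

  allRepBut⇒≤ : ∀ r → (∀ v → v ≢ r → IsRep v) → n ≤ suc k
  allRepBut⇒≤ r reps = injective⇒≤ {f = h} (λ {v} {w} → h-injective (v ≟ r) (w ≟ r))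
    where
      h′ : ∀ {v} → Dec (v ≡ r) → Fin (suc k)
      h′ (yes _) = zero
      h′ {v} (no _) = suc (f v)
      h : Fin n → Fin (suc k)
      h v = h′ (v ≟ r)
      h-injective : ∀ {v w} (v≟r : Dec (v ≡ r)) (w≟r : Dec (w ≡ r)) → h′ v≟r ≡ h′ w≟r → v ≡ w
      h-injective (yes v≡r) (yes w≡r) _ = trans v≡r (sym w≡r)
      h-injective {v} {w} (no v≢r) (no w≢r) hv≡hw =
        trans (IsRep⇒≡rep (reps v v≢r) (suc-injective hv≡hw)) (reps w w≢r)

  private
    enumerate : (rs : List (Fin n)) → Fin (length rs + k) → Fin n
    enumerate [] = rep
    enumerate (r ∷ rs) = r Vector.∷ enumerate rs

    enumerate-avoids : ∀ {r} rs → All (r ≢_) rs → ¬ IsRep r → ∀ i → enumerate rs i ≢ r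
    enumerate-avoids [] _ ¬rep i = rep≢nonRep ¬rep i
    enumerate-avoids (x ∷ rs) (r≢x ∷ _) ¬rep zero = ≢-sym r≢x
    enumerate-avoids (x ∷ rs) (_ ∷ r≢rs) ¬rep (suc i) = enumerate-avoids rs r≢rs ¬rep i

    enumerate-injective : ∀ rs → Unique rs → All (¬_ ∘ IsRep) rs → Injective _≡_ _≡_ (enumerate rs)
    enumerate-injective [] _ _ = rep-injective
    enumerate-injective (r ∷ rs) (r≢rs ∷ unique) (¬rep ∷ ¬reps) {zero} {zero} _ = refl
    enumerate-injective (r ∷ rs) (r≢rs ∷ unique) (¬rep ∷ ¬reps) {zero} {suc j} eq =
      ⊥-elim (enumerate-avoids rs r≢rs ¬rep j (sym eq))
    enumerate-injective (r ∷ rs) (r≢rs ∷ unique) (¬rep ∷ ¬reps) {suc i} {zero} eq =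
      ⊥-elim (enumerate-avoids rs r≢rs ¬rep i eq)
    enumerate-injective (r ∷ rs) (r≢rs ∷ unique) (¬rep ∷ ¬reps) {suc i} {suc j} eq =
      cong suc (enumerate-injective rs unique ¬reps eq)

  nonReps⇒≤ : ∀ rs → Unique rs → All (¬_ ∘ IsRep) rs → length rs + k ≤ n
  nonReps⇒≤ rs unique ¬reps = injective⇒≤ (enumerate-injective rs unique ¬reps)

  allRep-or-nonRep : (∀ v → IsRep v) ⊎ ∃[ r ] ¬ IsRep r
  allRep-or-nonRep with any? (¬? ∘ IsRep?)
  ... | yes nonRep = inj₂ nonRep
  ... | no ¬nonRep = inj₁ λ v → decidable-stable (IsRep? v) (λ ¬rep → ¬nonRep (v , ¬rep))

  allRepBut-or-nonRep : ∀ r → (∀ v → v ≢ r → IsRep v) ⊎ ∃[ r′ ] (r′ ≢ r × ¬ IsRep r′)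
  allRepBut-or-nonRep r with any? (λ v → ¬? (v ≟ r) ×-dec ¬? (IsRep? v))
  ... | yes nonRep = inj₂ nonRep
  ... | no ¬nonRep = inj₁ λ v v≢r → decidable-stable (IsRep? v) (λ ¬rep → ¬nonRep (v , v≢r , ¬rep))

module ClassUnions {n k : ℕ} {G : Graph n} (simple : IsSimple G)
                   (f : Fin n → Fin k) (surjective : ∀ i → ∃[ v ] (f v ≡ i)) where
  open SimpleGraph simple
  open Representatives f surjective public

  singleton∪singleton-DominatingEdge : ∀ {i j} → IsSingleton i → IsSingleton j →
                                       PairedDominating G (λ v → f v ≡ i ⊎ f v ≡ j) →
                                       DominatingEdge G (rep i) (rep j)
  singleton∪singleton-DominatingEdge {i} {j} single-i single-j PD =
    pair-PD⇒DominatingEdge PD (inj₁ (f-rep i)) (inj₂ (f-rep j)) (λ v → Sum.map (single-i v) (single-j v))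

  pair∪singleton-¬PD : ∀ {r j} → ¬ IsRep r → (∀ v → f v ≡ f r → v ≡ rep (f r) ⊎ v ≡ r) →
                       f r ≢ j → IsSingleton j → ¬ PairedDominating G (λ v → f v ≡ f r ⊎ f v ≡ j)
  pair∪singleton-¬PD {r} {j} ¬rep pair fr≢j single-j PD =
    triple-¬PM (rep≢nonRep ¬rep (f r)) (fr≢j ∘ rep-injective) (≢-sym (rep≢nonRep ¬rep j))
               (inj₁ (f-rep (f r))) (inj₁ refl) (inj₂ (f-rep j)) only (proj₂ PD)
    where
      only : ∀ v → f v ≡ f r ⊎ f v ≡ j → v ≡ rep (f r) ⊎ v ≡ r ⊎ v ≡ rep j
      only v (inj₁ fv≡fr) = Sum.map₂ inj₁ (pair v fv≡fr)
      only v (inj₂ fv≡j) = inj₂ (inj₂ (single-j v fv≡j))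

-- The order of a pc-partition

pendant-¬DominatingEdge : ∀ {n} {G : Graph n} {v₀ b t} → (∀ w → Adj G v₀ w → w ≡ b) →
                          t ≢ v₀ → t ≢ b → ¬ Adj G v₀ t → ¬ Adj G b t → ∀ w → ¬ DominatingEdge G v₀ w
pendant-¬DominatingEdge {t = t} only-b t≢v₀ t≢b v₀≁t b≁t w (dom , v₀∼w) with only-b w v₀∼w | dom t
... | refl | inj₁ (inj₁ t≡v₀) = t≢v₀ t≡v₀
... | refl | inj₁ (inj₂ t≡b) = t≢b t≡b
... | refl | inj₂ (_ , inj₁ refl , v₀∼t) = v₀≁t v₀∼t
... | refl | inj₂ (_ , inj₂ refl , b∼t) = b≁t b∼t

module _ {n : ℕ} {G : Graph n} (simple : IsSimple G) where

  HasPCPartition⇒≤n∸2 : ∀ v₀ → (∀ w → ¬ DominatingEdge G v₀ w) → ∀ k → HasPCPartition G k → k ≤ n ∸ 2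
  HasPCPartition⇒≤n∸2 v₀ v₀-undominated k (f , surjective , _ , partner) = bound
    where
      open ClassUnions simple f surjective

      singletons-impossible : (∀ v → IsRep v) → ⊥
      singletons-impossible reps with partner (f v₀)
      ... | j , _ , PD = v₀-undominated (rep j) (subst (λ u → DominatingEdge G u (rep j)) (reps v₀)
                                                       (singleton∪singleton-DominatingEdge single single PD))
        where
          single : ∀ {i} → IsSingleton i
          single v = IsRep⇒≡rep (reps v)

      one-pair-impossible : ∀ {r} → ¬ IsRep r → (∀ v → v ≢ r → IsRep v) → ⊥
      one-pair-impossible {r} ¬rep reps with partner (f r)
      ... | j , fr≢j , PD = pair∪singleton-¬PD ¬rep pair fr≢j single-j PD
        where
          pair : ∀ v → f v ≡ f r → v ≡ rep (f r) ⊎ v ≡ r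
          pair v fv≡fr with v ≟ r
          ... | yes v≡r = inj₂ v≡r
          ... | no v≢r = inj₁ (IsRep⇒≡rep (reps v v≢r) fv≡fr)
          single-j : IsSingleton j
          single-j v fv≡j = IsRep⇒≡rep (reps v λ { refl → fr≢j fv≡j }) fv≡j

      bound : k ≤ n ∸ 2
      bound with allRep-or-nonRep
      ... | inj₁ reps = ⊥-elim (singletons-impossible reps)
      ... | inj₂ (r , ¬rep) with allRepBut-or-nonRep r
      ...   | inj₁ reps = ⊥-elim (one-pair-impossible ¬rep reps)
      ...   | inj₂ (r′ , r′≢r , ¬rep′) =
              ∸-monoˡ-≤ 2 (nonReps⇒≤ (r ∷ r′ ∷ []) ((≢-sym r′≢r ∷ []) ∷ [] ∷ []) (¬rep ∷ ¬rep′ ∷ []))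

module _ {m : ℕ} {H : Graph (3 + m)} (simple : IsSimple H) where
  open SimpleGraph simple

  private
    leaf : Fin m → Fin (3 + m)
    leaf y = suc (suc (suc y))

  triple-pcPartition : (∀ y → Matching₄ H (leaf y) zero (suc zero) (suc (suc zero))) → Fin m →
                       HasPCPartition H (suc m)
  triple-pcPartition matched y₀ = f , surjective , ¬PD , partner
    where
      f : Fin (3 + m) → Fin (suc m)
      f zero = zero
      f (suc zero) = zero
      f (suc (suc zero)) = zero
      f (suc (suc (suc y))) = suc y

      surjective : ∀ i → ∃[ v ] (f v ≡ i)
      surjective zero = zero , refl
      surjective (suc y) = leaf y , refl

      only-triple : ∀ v → f v ≡ zero → v ≡ zero ⊎ v ≡ suc zero ⊎ v ≡ suc (suc zero)
      only-triple zero _ = inj₁ refl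
      only-triple (suc zero) _ = inj₂ (inj₁ refl)
      only-triple (suc (suc zero)) _ = inj₂ (inj₂ refl)

      only-leaf : ∀ {y} v → f v ≡ suc y → v ≡ leaf y
      only-leaf (suc (suc (suc y))) refl = refl

      ¬PD : ∀ i → ¬ PairedDominating H (λ v → f v ≡ i)
      ¬PD zero PD = triple-¬PM (λ ()) (λ ()) (λ ()) refl refl refl only-triple (proj₂ PD)
      ¬PD (suc y) PD = singleton-¬PM refl only-leaf (proj₂ PD)

      triple∪leaf-PD : ∀ y → PairedDominating H (λ v → f v ≡ zero ⊎ f v ≡ suc y)
      triple∪leaf-PD y =
        dominating ,
        Matching₄⇒HasPM (λ ()) (λ ()) (λ ()) ((λ ()) , (λ ()) , (λ ()))
                        (inj₂ refl) (inj₁ refl) (inj₁ refl) (inj₁ refl) only (matched y)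
        where
          only : ∀ v → f v ≡ zero ⊎ f v ≡ suc y → v ≡ leaf y ⊎ v ≡ zero ⊎ v ≡ suc zero ⊎ v ≡ suc (suc zero)
          only v (inj₁ fv≡0) = inj₂ (only-triple v fv≡0)
          only v (inj₂ fv≡y) = inj₁ (only-leaf v fv≡y)
          dominating : Dominating H (λ v → f v ≡ zero ⊎ f v ≡ suc y)
          dominating zero = inj₁ (inj₁ refl)
          dominating (suc zero) = inj₁ (inj₁ refl)
          dominating (suc (suc zero)) = inj₁ (inj₁ refl)
          dominating (suc (suc (suc y′))) with matched y′
          ... | u∼x₁ ℓ∼x _ = inj₂ (zero , inj₁ refl , Adj-sym ℓ∼x)
          ... | u∼x₂ ℓ∼x _ = inj₂ (suc zero , inj₁ refl , Adj-sym ℓ∼x)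
          ... | u∼x₃ ℓ∼x _ = inj₂ (suc (suc zero) , inj₁ refl , Adj-sym ℓ∼x)

      partner : ∀ i → ∃[ j ] (i ≢ j × PairedDominating H (λ v → f v ≡ i ⊎ f v ≡ j))
      partner zero = suc y₀ , (λ ()) , triple∪leaf-PD y₀
      partner (suc y) = zero , (λ ()) , PairedDominating-∪-comm (triple∪leaf-PD y)

-- Subdivided double stars

data Role : Set where
  supportA supportB centre leafA leafB : Role

-- Oriented like sdEdge, so that sdEdge-role below holds edge by edge.
roleEdge : Role → Role → Bool
roleEdge supportA centre = true
roleEdge supportB centre = true
roleEdge supportA leafA = true
roleEdge supportB leafB = true
roleEdge _ _ = false

roleAdj : Role → Role → Bool
roleAdj r s = roleEdge r s ∨ roleEdge s r

leafRole : ℕ → ℕ → Role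
leafRole p t = if t <ᵇ p then leafA else leafB

leafRole-≡ : ∀ p t {b} → (t <ᵇ p) ≡ b → leafRole p t ≡ (if b then leafA else leafB)
leafRole-≡ p t = cong (λ b → if b then leafA else leafB)

sdsRole : ∀ p q → Fin (3 + p + q) → Role
sdsRole p q zero = supportA
sdsRole p q (suc zero) = supportB
sdsRole p q (suc (suc zero)) = centre
sdsRole p q (suc (suc (suc y))) = leafRole p (toℕ y)

toℕ<ᵇ : ∀ {m} (i : Fin m) → (toℕ i <ᵇ m) ≡ true
toℕ<ᵇ zero = refl
toℕ<ᵇ (suc i) = toℕ<ᵇ i

<ᵇ-suc-flip : ∀ t p → (p <ᵇ suc t) ≡ not (t <ᵇ p)
<ᵇ-suc-flip zero zero = refl
<ᵇ-suc-flip zero (suc p) = refl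
<ᵇ-suc-flip (suc t) zero = refl
<ᵇ-suc-flip (suc t) (suc p) = <ᵇ-suc-flip t p

+<ᵇ-false : ∀ p t → (p + t <ᵇ p) ≡ false
+<ᵇ-false zero t = refl
+<ᵇ-false (suc p) t = +<ᵇ-false p t

sdEdge-role : ∀ p q (y z : Fin (3 + p + q)) →
              sdEdge p q (toℕ y) (toℕ z) ≡ roleEdge (sdsRole p q y) (sdsRole p q z)
sdEdge-role p q zero zero = refl
sdEdge-role p q zero (suc zero) = refl
sdEdge-role p q zero (suc (suc zero)) = refl
sdEdge-role p q zero (suc (suc (suc z))) with toℕ z <ᵇ p
... | true = refl
... | false = refl
sdEdge-role p q (suc zero) zero = refl
sdEdge-role p q (suc zero) (suc zero) = refl
sdEdge-role p q (suc zero) (suc (suc zero)) = refl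
sdEdge-role p q (suc zero) (suc (suc (suc z))) rewrite <ᵇ-suc-flip (toℕ z) p | toℕ<ᵇ z with toℕ z <ᵇ p
... | true = refl
... | false = refl
sdEdge-role p q (suc (suc zero)) z = refl
sdEdge-role p q (suc (suc (suc y))) z with toℕ y <ᵇ p
... | true = refl
... | false = refl

SubdividedDoubleStar-role : ∀ p q (y z : Fin (3 + p + q)) →
                            SubdividedDoubleStar p q y z ≡ roleAdj (sdsRole p q y) (sdsRole p q z)
SubdividedDoubleStar-role p q y z = cong₂ _∨_ (sdEdge-role p q y z) (sdEdge-role p q z y)

roleAdj-irrefl : ∀ r → roleAdj r r ≡ false
roleAdj-irrefl supportA = refl
roleAdj-irrefl supportB = refl
roleAdj-irrefl centre = refl
roleAdj-irrefl leafA = refl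
roleAdj-irrefl leafB = refl

roleAdj-leafB : ∀ r → roleAdj leafB r ≡ true → r ≡ supportB
roleAdj-leafB supportB _ = refl

sdsRole-supportB : ∀ p q (v : Fin (3 + p + q)) → sdsRole p q v ≡ supportB → v ≡ suc zero
sdsRole-supportB p q (suc zero) _ = refl
sdsRole-supportB p q (suc (suc (suc y))) eq with toℕ y <ᵇ p
sdsRole-supportB p q (suc (suc (suc y))) () | true
sdsRole-supportB p q (suc (suc (suc y))) () | false

module _ (p q : ℕ) where

  SubdividedDoubleStar-roles : ∀ y z {r s} → sdsRole p q y ≡ r → sdsRole p q z ≡ s →
                               SubdividedDoubleStar p q y z ≡ roleAdj r s
  SubdividedDoubleStar-roles y z refl refl = SubdividedDoubleStar-role p q y z

  SubdividedDoubleStar-simple : IsSimple (SubdividedDoubleStar p q)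
  SubdividedDoubleStar-simple =
    (λ u v → ∨-comm (sdEdge p q (toℕ u) (toℕ v)) _) ,
    (λ v → trans (SubdividedDoubleStar-role p q v v) (roleAdj-irrefl (sdsRole p q v)))

  SubdividedDoubleStar-leaf-matched :
    ∀ y → Matching₄ (SubdividedDoubleStar p q) (suc (suc (suc y))) zero (suc zero) (suc (suc zero))
  SubdividedDoubleStar-leaf-matched y with toℕ y <ᵇ p in leaf-of-a
  ... | true = u∼x₁ (SubdividedDoubleStar-roles _ zero (leafRole-≡ p (toℕ y) leaf-of-a) refl) refl
  ... | false = u∼x₂ (SubdividedDoubleStar-roles _ (suc zero) (leafRole-≡ p (toℕ y) leaf-of-a) refl) refl

SubdividedDoubleStar-PCis : ∀ p q → PCis (SubdividedDoubleStar p (suc q)) (suc (p + suc q))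
SubdividedDoubleStar-PCis p q =
  inj₂ ( triple-pcPartition simple (SubdividedDoubleStar-leaf-matched p (suc q)) (p ↑ʳ zero)
       , HasPCPartition⇒≤n∸2 simple v₀ (pendant-¬DominatingEdge {t = zero} only-b (λ ()) (λ ()) v₀≁a (λ ())))
  where
    H = SubdividedDoubleStar p (suc q)
    simple = SubdividedDoubleStar-simple p (suc q)
    v₀ : Fin (3 + p + suc q)
    v₀ = suc (suc (suc (p ↑ʳ zero)))

    role-v₀ : sdsRole p (suc q) v₀ ≡ leafB
    role-v₀ rewrite toℕ-↑ʳ p (zero {q}) | +<ᵇ-false p 0 = refl

    role-adj : ∀ w → H v₀ w ≡ roleAdj leafB (sdsRole p (suc q) w)
    role-adj w = SubdividedDoubleStar-roles p (suc q) v₀ w role-v₀ refl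

    only-b : ∀ w → Adj H v₀ w → w ≡ suc zero
    only-b w v₀∼w = sdsRole-supportB p (suc q) w (roleAdj-leafB _ (trans (sym (role-adj w)) v₀∼w))

    v₀≁a : ¬ Adj H v₀ zero
    v₀≁a v₀∼a with () ← trans (sym (role-adj zero)) v₀∼a

swap₀₂ : ∀ {m} → Fin (3 + m) → Fin (3 + m)
swap₀₂ zero = suc (suc zero)
swap₀₂ (suc zero) = suc zero
swap₀₂ (suc (suc zero)) = zero
swap₀₂ (suc (suc (suc y))) = suc (suc (suc y))

swap₀₂-involutive : ∀ {m} (v : Fin (3 + m)) → swap₀₂ (swap₀₂ v) ≡ v
swap₀₂-involutive zero = refl
swap₀₂-involutive (suc zero) = refl
swap₀₂-involutive (suc (suc zero)) = refl
swap₀₂-involutive (suc (suc (suc y))) = refl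

-- Subdividing the edge between the supports of S₀,q makes the leafless support a leaf of the new vertex.
SubdividedDoubleStar₀≅DoubleStar₁ : ∀ q → SubdividedDoubleStar 0 q ≅ DoubleStar 1 q
SubdividedDoubleStar₀≅DoubleStar₁ q = mk↔ₛ′ swap₀₂ swap₀₂ swap₀₂-involutive swap₀₂-involutive , adjacency
  where
    adjacency : ∀ u v → SubdividedDoubleStar 0 q u v ≡ DoubleStar 1 q (swap₀₂ u) (swap₀₂ v)
    adjacency zero zero = refl
    adjacency zero (suc zero) = refl
    adjacency zero (suc (suc zero)) = refl
    adjacency zero (suc (suc (suc y))) = refl
    adjacency (suc zero) zero = refl
    adjacency (suc zero) (suc zero) = refl
    adjacency (suc zero) (suc (suc zero)) = refl
    adjacency (suc zero) (suc (suc (suc y))) = refl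
    adjacency (suc (suc zero)) zero = refl
    adjacency (suc (suc zero)) (suc zero) = refl
    adjacency (suc (suc zero)) (suc (suc zero)) = refl
    adjacency (suc (suc zero)) (suc (suc (suc y))) = refl
    adjacency (suc (suc (suc x))) zero = refl
    adjacency (suc (suc (suc x))) (suc zero) = refl
    adjacency (suc (suc (suc x))) (suc (suc zero)) = refl
    adjacency (suc (suc (suc x))) (suc (suc (suc y))) = refl

-- Unlike in the theorem, p = 0 is allowed: this covers S₁,q (SubdividedDoubleStar₀≅DoubleStar₁).
IsSubdividedDoubleStar : ∀ {n} → Graph n → Set
IsSubdividedDoubleStar T = ∃[ p ] ∃[ q ] (1 ≤ q × T ≅ SubdividedDoubleStar p q)

-- Recognising subdivided double stars

index-lookup : ∀ {A : Set} {xs : List A} → Unique xs → ∀ i (i∈xs : List.lookup xs i ∈ xs) → Any.index i∈xs ≡ i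
index-lookup {xs = x ∷ xs} _ zero (here _) = refl
index-lookup {xs = x ∷ xs} (x∉xs ∷ _) zero (there x∈xs) = ⊥-elim (All.lookup x∉xs x∈xs refl)
index-lookup {xs = x ∷ xs} (x∉xs ∷ _) (suc i) (here xs[i]≡x) =
  ⊥-elim (All.lookup x∉xs (∈-lookup i) (sym xs[i]≡x))
index-lookup {xs = x ∷ xs} (_ ∷ unique) (suc i) (there xs[i]∈xs) = cong suc (index-lookup unique i xs[i]∈xs)

leafA? : ∀ r → Dec (r ≡ leafA)
leafA? supportA = no λ ()
leafA? supportB = no λ ()
leafA? centre = no λ ()
leafA? leafA = yes refl
leafA? leafB = no λ ()

leafB? : ∀ r → Dec (r ≡ leafB)
leafB? supportA = no λ ()
leafB? supportB = no λ ()
leafB? centre = no λ ()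
leafB? leafA = no λ ()
leafB? leafB = yes refl

module RoleIsomorphism {n : ℕ} {G : Graph n} (role : Fin n → Role) {a b c : Fin n}
  (role-a : role a ≡ supportA) (role-b : role b ≡ supportB) (role-c : role c ≡ centre)
  (supportA-unique : ∀ u → role u ≡ supportA → u ≡ a)
  (supportB-unique : ∀ u → role u ≡ supportB → u ≡ b)
  (centre-unique : ∀ u → role u ≡ centre → u ≡ c)
  (G-role : ∀ u v → G u v ≡ roleAdj (role u) (role v)) where

  leavesA : List (Fin n)
  leavesA = filter (leafA? ∘ role) (allFin n)

  leavesB : List (Fin n)
  leavesB = filter (leafB? ∘ role) (allFin n)

  private
    p = length leavesA
    q = length leavesB

    ∈leavesA : ∀ {u} → role u ≡ leafA → u ∈ leavesA
    ∈leavesA = ∈-filter⁺ (leafA? ∘ role) (∈-allFin _)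

    ∈leavesB : ∀ {u} → role u ≡ leafB → u ∈ leavesB
    ∈leavesB = ∈-filter⁺ (leafB? ∘ role) (∈-allFin _)

    lookupA-role : ∀ i → role (List.lookup leavesA i) ≡ leafA
    lookupA-role i = proj₂ (∈-filter⁻ (leafA? ∘ role) {xs = allFin n} (∈-lookup i))

    lookupB-role : ∀ i → role (List.lookup leavesB i) ≡ leafB
    lookupB-role i = proj₂ (∈-filter⁻ (leafB? ∘ role) {xs = allFin n} (∈-lookup i))

    indexA-lookup : ∀ i → Any.index (∈leavesA (lookupA-role i)) ≡ i
    indexA-lookup i = index-lookup (filter⁺ (leafA? ∘ role) (allFin⁺ n)) i _

    indexB-lookup : ∀ i → Any.index (∈leavesB (lookupB-role i)) ≡ i
    indexB-lookup i = index-lookup (filter⁺ (leafB? ∘ role) (allFin⁺ n)) i _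

    leaf : Fin (p + q) → Fin (3 + p + q)
    leaf y = suc (suc (suc y))

    leaf-join : ∀ {y s} → splitAt p y ≡ s → leaf (join p q s) ≡ leaf y
    leaf-join {y} split = cong leaf (trans (cong (join p q) (sym split)) (join-splitAt p q y))

    position : ∀ u {r} → role u ≡ r → Fin (3 + p + q)
    position u {supportA} _ = zero
    position u {supportB} _ = suc zero
    position u {centre} _ = suc (suc zero)
    position u {leafA} eq = leaf (Any.index (∈leavesA eq) ↑ˡ q)
    position u {leafB} eq = leaf (p ↑ʳ Any.index (∈leavesB eq))

    to : Fin n → Fin (3 + p + q)
    to u = position u refl

    to-position : ∀ u {r} (eq : role u ≡ r) → to u ≡ position u eq
    to-position u refl = refl

    from : Fin (3 + p + q) → Fin n
    from zero = a
    from (suc zero) = b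
    from (suc (suc zero)) = c
    from (suc (suc (suc y))) = [ List.lookup leavesA , List.lookup leavesB ]′ (splitAt p y)

    from-position : ∀ u {r} (eq : role u ≡ r) → from (position u eq) ≡ u
    from-position u {supportA} eq = sym (supportA-unique u eq)
    from-position u {supportB} eq = sym (supportB-unique u eq)
    from-position u {centre} eq = sym (centre-unique u eq)
    from-position u {leafA} eq rewrite splitAt-↑ˡ p (Any.index (∈leavesA eq)) q =
      sym (lookup-index (∈leavesA eq))
    from-position u {leafB} eq rewrite splitAt-↑ʳ p q (Any.index (∈leavesB eq)) =
      sym (lookup-index (∈leavesB eq))

    to-from : ∀ y → to (from y) ≡ y
    to-from zero = to-position a role-a
    to-from (suc zero) = to-position b role-b
    to-from (suc (suc zero)) = to-position c role-c
    to-from (suc (suc (suc y))) with splitAt p y in split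
    ... | inj₁ i = begin
      to (List.lookup leavesA i)                   ≡⟨ to-position _ (lookupA-role i) ⟩
      leaf (Any.index (∈leavesA _) ↑ˡ q)           ≡⟨ cong (λ j → leaf (j ↑ˡ q)) (indexA-lookup i) ⟩
      leaf (join p q (inj₁ i))                     ≡⟨ leaf-join split ⟩
      leaf y                                       ∎
      where open ≡-Reasoning
    ... | inj₂ i = begin
      to (List.lookup leavesB i)                   ≡⟨ to-position _ (lookupB-role i) ⟩
      leaf (p ↑ʳ Any.index (∈leavesB _))           ≡⟨ cong (λ j → leaf (p ↑ʳ j)) (indexB-lookup i) ⟩
      leaf (join p q (inj₂ i))                     ≡⟨ leaf-join split ⟩
      leaf y                                       ∎
      where open ≡-Reasoning

    sdsRole-position : ∀ u {r} (eq : role u ≡ r) → sdsRole p q (position u eq) ≡ r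
    sdsRole-position u {supportA} eq = refl
    sdsRole-position u {supportB} eq = refl
    sdsRole-position u {centre} eq = refl
    sdsRole-position u {leafA} eq
      rewrite toℕ-↑ˡ (Any.index (∈leavesA eq)) q | toℕ<ᵇ (Any.index (∈leavesA eq)) = refl
    sdsRole-position u {leafB} eq
      rewrite toℕ-↑ʳ p (Any.index (∈leavesB eq)) | +<ᵇ-false p (toℕ (Any.index (∈leavesB eq))) = refl

  ≅SubdividedDoubleStar : G ≅ SubdividedDoubleStar p q
  ≅SubdividedDoubleStar = mk↔ₛ′ to from to-from (λ u → from-position u refl) , λ u v → begin
    G u v                                              ≡⟨ G-role u v ⟩
    roleAdj (role u) (role v)                          ≡⟨ cong₂ roleAdj (sym (sdsRole-position u refl))
                                                                        (sym (sdsRole-position v refl)) ⟩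
    roleAdj (sdsRole p q (to u)) (sdsRole p q (to v))  ≡⟨ sym (SubdividedDoubleStar-role p q (to u) (to v)) ⟩
    SubdividedDoubleStar p q (to u) (to v)             ∎
    where open ≡-Reasoning

  leafB⇒leavesB-nonempty : ∀ {u} → role u ≡ leafB → 1 ≤ length leavesB
  leafB⇒leavesB-nonempty eq = ≤-trans (s≤s z≤n) (toℕ<n (Any.index (∈leavesB eq)))

-- S_{p,q} (p ≥ 0, q ≥ 1) with its central edge a – b subdivided by c.
record SubdividedDoubleStarShape {n : ℕ} (G : Graph n) : Set where
  field
    a b c : Fin n
    a≢b : a ≢ b
    a≢c : a ≢ c
    b≢c : b ≢ c
    a∼c : Adj G a c
    b∼c : Adj G b c
    leaf : ∀ u → Outside G a b c u → Adj G u a ⊎ Adj G u b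
    b-leaf : ∃[ u ] (Outside G a b c u × Adj G u b)

module FromShape {n : ℕ} {G : Graph n} (simple : IsSimple G) (acyclic : Acyclic G)
                 (shape : SubdividedDoubleStarShape G) where
  open SimpleGraph simple
  open Forest simple acyclic
  open SubdividedDoubleStarShape shape

  role : Fin n → Role
  role u with u ≟ a | u ≟ b | u ≟ c | G u a
  ... | yes _ | _     | _     | _     = supportA
  ... | no _  | yes _ | _     | _     = supportB
  ... | no _  | no _  | yes _ | _     = centre
  ... | no _  | no _  | no _  | true  = leafA
  ... | no _  | no _  | no _  | false = leafB

  data View (u : Fin n) : Role → Set where
    is-a : u ≡ a → View u supportA
    is-b : u ≡ b → View u supportB
    is-c : u ≡ c → View u centre
    leaf-a : Outside G a b c u → Adj G u a → View u leafA
    leaf-b : Outside G a b c u → ¬ Adj G u a → Adj G u b → View u leafB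

  view : ∀ u → View u (role u)
  view u with u ≟ a | u ≟ b | u ≟ c | G u a in u∼a?
  ... | yes u≡a | _       | _       | _     = is-a u≡a
  ... | no _    | yes u≡b | _       | _     = is-b u≡b
  ... | no _    | no _    | yes u≡c | _     = is-c u≡c
  ... | no u≢a  | no u≢b  | no u≢c  | true  = leaf-a (u≢a , u≢b , u≢c) u∼a?
  ... | no u≢a  | no u≢b  | no u≢c  | false = leaf-b (u≢a , u≢b , u≢c) (λ u∼a → not-¬ u∼a? u∼a) u∼b
    where
      u∼b : Adj G u b
      u∼b with leaf u (u≢a , u≢b , u≢c)
      ... | inj₁ u∼a = ⊥-elim (not-¬ u∼a? u∼a)
      ... | inj₂ u∼b = u∼b

  private
    ≁⇒false : ∀ {u v} → ¬ Adj G u v → G u v ≡ false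
    ≁⇒false = ¬-not

    a≁b : ¬ Adj G a b
    a≁b a∼b = no-triangle a∼b b∼c (Adj-sym a∼c)

    irrefl : ∀ u → G u u ≡ false
    irrefl = proj₂ simple

  -- Every non-edge comes from the absence of cycles of length at most 5.
  G-role : ∀ u v → G u v ≡ roleAdj (role u) (role v)
  G-role u v with role u | view u | role v | view v
  ... | _ | is-a refl | _ | is-a refl = irrefl a
  ... | _ | is-a refl | _ | is-b refl = ≁⇒false a≁b
  ... | _ | is-a refl | _ | is-c refl = a∼c
  ... | _ | is-a refl | _ | leaf-a _ v∼a = Adj-sym v∼a
  ... | _ | is-a refl | _ | leaf-b _ v≁a _ = ≁⇒false (v≁a ∘ Adj-sym)
  ... | _ | is-b refl | _ | is-a refl = ≁⇒false (a≁b ∘ Adj-sym)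
  ... | _ | is-b refl | _ | is-b refl = irrefl b
  ... | _ | is-b refl | _ | is-c refl = b∼c
  ... | _ | is-b refl | _ | leaf-a (_ , _ , v≢c) v∼a =
        ≁⇒false λ b∼v → no-square (≢-sym a≢b) v≢c b∼v v∼a a∼c (Adj-sym b∼c)
  ... | _ | is-b refl | _ | leaf-b _ _ v∼b = Adj-sym v∼b
  ... | _ | is-c refl | _ | is-a refl = Adj-sym a∼c
  ... | _ | is-c refl | _ | is-b refl = Adj-sym b∼c
  ... | _ | is-c refl | _ | is-c refl = irrefl c
  ... | _ | is-c refl | _ | leaf-a _ v∼a = ≁⇒false λ c∼v → no-triangle c∼v v∼a a∼c
  ... | _ | is-c refl | _ | leaf-b _ _ v∼b = ≁⇒false λ c∼v → no-triangle c∼v v∼b b∼c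
  ... | _ | leaf-a _ u∼a | _ | is-a refl = u∼a
  ... | _ | leaf-a (_ , _ , u≢c) u∼a | _ | is-b refl =
        ≁⇒false λ u∼b → no-square (≢-sym a≢b) u≢c (Adj-sym u∼b) u∼a a∼c (Adj-sym b∼c)
  ... | _ | leaf-a _ u∼a | _ | is-c refl = ≁⇒false λ u∼c → no-triangle (Adj-sym u∼c) u∼a a∼c
  ... | _ | leaf-a _ u∼a | _ | leaf-a _ v∼a = ≁⇒false λ u∼v → no-triangle u∼v v∼a (Adj-sym u∼a)
  ... | _ | leaf-a (_ , u≢b , u≢c) u∼a | _ | leaf-b (v≢a , _ , v≢c) _ v∼b =
        ≁⇒false λ u∼v → no-pentagon u≢b u≢c v≢c v≢a (≢-sym a≢b) u∼v v∼b b∼c (Adj-sym a∼c) (Adj-sym u∼a)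
  ... | _ | leaf-b _ u≁a _ | _ | is-a refl = ≁⇒false u≁a
  ... | _ | leaf-b _ _ u∼b | _ | is-b refl = u∼b
  ... | _ | leaf-b _ _ u∼b | _ | is-c refl = ≁⇒false λ u∼c → no-triangle (Adj-sym u∼c) u∼b b∼c
  ... | _ | leaf-b (u≢a , _ , u≢c) _ u∼b | _ | leaf-a (_ , v≢b , v≢c) v∼a =
        ≁⇒false λ u∼v →
          no-pentagon v≢b v≢c u≢c u≢a (≢-sym a≢b) (Adj-sym u∼v) u∼b b∼c (Adj-sym a∼c) (Adj-sym v∼a)
  ... | _ | leaf-b _ _ u∼b | _ | leaf-b _ _ v∼b = ≁⇒false λ u∼v → no-triangle u∼v v∼b (Adj-sym u∼b)

  role-a : role a ≡ supportA
  role-a with role a | view a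
  ... | _ | is-a _ = refl
  ... | _ | is-b a≡b = ⊥-elim (a≢b a≡b)
  ... | _ | is-c a≡c = ⊥-elim (a≢c a≡c)
  ... | _ | leaf-a (a≢a , _) _ = ⊥-elim (a≢a refl)
  ... | _ | leaf-b (a≢a , _) _ _ = ⊥-elim (a≢a refl)

  role-b : role b ≡ supportB
  role-b with role b | view b
  ... | _ | is-a b≡a = ⊥-elim (a≢b (sym b≡a))
  ... | _ | is-b _ = refl
  ... | _ | is-c b≡c = ⊥-elim (b≢c b≡c)
  ... | _ | leaf-a (_ , b≢b , _) _ = ⊥-elim (b≢b refl)
  ... | _ | leaf-b (_ , b≢b , _) _ _ = ⊥-elim (b≢b refl)

  role-c : role c ≡ centre
  role-c with role c | view c
  ... | _ | is-a c≡a = ⊥-elim (a≢c (sym c≡a))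
  ... | _ | is-b c≡b = ⊥-elim (b≢c (sym c≡b))
  ... | _ | is-c _ = refl
  ... | _ | leaf-a (_ , _ , c≢c) _ = ⊥-elim (c≢c refl)
  ... | _ | leaf-b (_ , _ , c≢c) _ _ = ⊥-elim (c≢c refl)

  supportA-unique : ∀ u → role u ≡ supportA → u ≡ a
  supportA-unique u eq with role u | view u
  supportA-unique u refl | _ | is-a u≡a = u≡a

  supportB-unique : ∀ u → role u ≡ supportB → u ≡ b
  supportB-unique u eq with role u | view u
  supportB-unique u refl | _ | is-b u≡b = u≡b

  centre-unique : ∀ u → role u ≡ centre → u ≡ c
  centre-unique u eq with role u | view u
  centre-unique u refl | _ | is-c u≡c = u≡c

  b-leaf-role : ∀ {u} → Outside G a b c u → Adj G u b → role u ≡ leafB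
  b-leaf-role {u} (u≢a , u≢b , u≢c) u∼b with role u | view u
  ... | _ | is-a u≡a = ⊥-elim (u≢a u≡a)
  ... | _ | is-b u≡b = ⊥-elim (u≢b u≡b)
  ... | _ | is-c u≡c = ⊥-elim (u≢c u≡c)
  ... | _ | leaf-a _ u∼a = ⊥-elim (no-square a≢b u≢c (Adj-sym u∼a) u∼b b∼c (Adj-sym a∼c))
  ... | _ | leaf-b _ _ _ = refl

  open RoleIsomorphism role role-a role-b role-c supportA-unique supportB-unique centre-unique G-role

  isSubdividedDoubleStar : IsSubdividedDoubleStar G
  isSubdividedDoubleStar =
    length leavesA , length leavesB ,
    leafB⇒leavesB-nonempty (b-leaf-role (proj₁ (proj₂ b-leaf)) (proj₂ (proj₂ b-leaf))) ,
    ≅SubdividedDoubleStar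

record MatchedTriple {n : ℕ} (G : Graph n) : Set where
  field
    x₁ x₂ x₃ : Fin n
    x₁≢x₂ : x₁ ≢ x₂
    x₁≢x₃ : x₁ ≢ x₃
    x₂≢x₃ : x₂ ≢ x₃
    outsider : ∃ (Outside G x₁ x₂ x₃)
    matched : ∀ u → Outside G x₁ x₂ x₃ u → Matching₄ G u x₁ x₂ x₃

module TreeShape {n : ℕ} {G : Graph n} (simple : IsSimple G) (acyclic : Acyclic G) (connected : Connected G)
                 where
  open SimpleGraph simple
  open Forest simple acyclic

  path-shape : ∀ {a b c} → a ≢ b → a ≢ c → b ≢ c → Adj G a c → Adj G b c →
               (∀ u → Outside G a b c u → Adj G u a ⊎ Adj G u b) → ∃ (Outside G a b c) →
               SubdividedDoubleStarShape G
  path-shape {a} {b} {c} a≢b a≢c b≢c a∼c b∼c leaf (s , s-out@(s≢a , s≢b , s≢c)) with leaf s s-out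
  ... | inj₂ s∼b = record
    { a = a ; b = b ; c = c ; a≢b = a≢b ; a≢c = a≢c ; b≢c = b≢c ; a∼c = a∼c ; b∼c = b∼c
    ; leaf = leaf ; b-leaf = s , s-out , s∼b }
  ... | inj₁ s∼a = record
    { a = b ; b = a ; c = c ; a≢b = ≢-sym a≢b ; a≢c = b≢c ; b≢c = a≢c ; a∼c = b∼c ; b∼c = a∼c
    ; leaf = λ u (u≢b , u≢a , u≢c) → Sum.swap (leaf u (u≢a , u≢b , u≢c))
    ; b-leaf = s , (s≢b , s≢a , s≢c) , s∼a }

  private
    attach : ∀ {a b c u} → a ≢ b → a ≢ c → b ≢ c → Adj G b c → ¬ Adj G a b → u ≢ b → u ≢ c → Adj G u b →
             (∀ w → Outside G a b c w → Adj G w a) → SubdividedDoubleStarShape G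
    attach {a} {b} {c} {u} a≢b a≢c b≢c b∼c a≁b u≢b u≢c u∼b leaf-a = record
      { a = a ; b = b ; c = u ; a≢b = a≢b ; a≢c = ≢-sym u≢a ; b≢c = ≢-sym u≢b
      ; a∼c = Adj-sym (leaf-a u (u≢a , u≢b , u≢c)) ; b∼c = Adj-sym u∼b
      ; leaf = leaf ; b-leaf = c , (≢-sym a≢c , ≢-sym b≢c , ≢-sym u≢c) , Adj-sym b∼c }
      where
        u≢a : u ≢ a
        u≢a refl = a≁b u∼b
        leaf : ∀ w → Outside G a b u w → Adj G w a ⊎ Adj G w b
        leaf w (w≢a , w≢b , _) with w ≟ c
        ... | yes refl = inj₂ (Adj-sym b∼c)
        ... | no w≢c = inj₁ (leaf-a w (w≢a , w≢b , w≢c))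

  -- The walk from a to b enters {b, c} through an outside vertex, which becomes the subdivision vertex.
  edge-shape : ∀ {a b c} → a ≢ b → a ≢ c → b ≢ c → Adj G b c → ¬ Adj G a b → ¬ Adj G a c →
               (∀ u → Outside G a b c u → Adj G u a) → SubdividedDoubleStarShape G
  edge-shape {a} {b} {c} a≢b a≢c b≢c b∼c a≁b a≁c leaf-a
    with boundary-edge (λ u → ¬? (u ≟ b) ×-dec ¬? (u ≟ c)) (a≢b , a≢c) (λ (b≢b , _) → b≢b refl) (connected a b)
  ... | u , v , (u≢b , u≢c) , v∉bc , u∼v with v ≟ b | v ≟ c
  ... | yes refl | _ = attach a≢b a≢c b≢c b∼c a≁b u≢b u≢c u∼v leaf-a
  ... | no _ | yes refl = attach a≢c a≢b (≢-sym b≢c) (Adj-sym b∼c) a≁c u≢c u≢b u∼v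
                                 (λ w (w≢a , w≢c , w≢b) → leaf-a w (w≢a , w≢b , w≢c))
  ... | no v≢b | no v≢c = ⊥-elim (v∉bc (v≢b , v≢c))

  private
    adj? : ∀ u v → Dec (Adj G u v)
    adj? u v = G u v Bool.≟ true

  shape-with-edge₂₃ : ∀ {x₁ x₂ x₃} → x₁ ≢ x₂ → x₁ ≢ x₃ → x₂ ≢ x₃ → Adj G x₂ x₃ →
                      (∀ u → Outside G x₁ x₂ x₃ u → Matching₄ G u x₁ x₂ x₃) → ∃ (Outside G x₁ x₂ x₃) →
                      SubdividedDoubleStarShape G
  shape-with-edge₂₃ {x₁} {x₂} {x₃} x₁≢x₂ x₁≢x₃ x₂≢x₃ x₂∼x₃ matched (s , s≢x₁ , s≢x₂ , s≢x₃)
    with adj? x₁ x₂ | adj? x₁ x₃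
  ... | yes x₁∼x₂ | yes x₁∼x₃ = ⊥-elim (no-triangle x₁∼x₂ x₂∼x₃ (Adj-sym x₁∼x₃))
  ... | yes x₁∼x₂ | no x₁≁x₃ =
        path-shape x₁≢x₃ x₁≢x₂ (≢-sym x₂≢x₃) x₁∼x₂ (Adj-sym x₂∼x₃) leaf (s , s≢x₁ , s≢x₃ , s≢x₂)
    where
      leaf : ∀ u → Outside G x₁ x₃ x₂ u → Adj G u x₁ ⊎ Adj G u x₃
      leaf u (u≢x₁ , u≢x₃ , u≢x₂) with matched u (u≢x₁ , u≢x₂ , u≢x₃)
      ... | u∼x₁ u∼x _ = inj₁ u∼x
      ... | u∼x₂ _ x₁∼x₃ = ⊥-elim (x₁≁x₃ x₁∼x₃)
      ... | u∼x₃ u∼x _ = inj₂ u∼x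
  ... | no x₁≁x₂ | yes x₁∼x₃ =
        path-shape x₁≢x₂ x₁≢x₃ x₂≢x₃ x₁∼x₃ x₂∼x₃ leaf (s , s≢x₁ , s≢x₂ , s≢x₃)
    where
      leaf : ∀ u → Outside G x₁ x₂ x₃ u → Adj G u x₁ ⊎ Adj G u x₂
      leaf u u-out with matched u u-out
      ... | u∼x₁ u∼x _ = inj₁ u∼x
      ... | u∼x₂ u∼x _ = inj₂ u∼x
      ... | u∼x₃ _ x₁∼x₂ = ⊥-elim (x₁≁x₂ x₁∼x₂)
  ... | no x₁≁x₂ | no x₁≁x₃ = edge-shape x₁≢x₂ x₁≢x₃ x₂≢x₃ x₂∼x₃ x₁≁x₂ x₁≁x₃ leaf-x₁
    where
      leaf-x₁ : ∀ u → Outside G x₁ x₂ x₃ u → Adj G u x₁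
      leaf-x₁ u u-out with matched u u-out
      ... | u∼x₁ u∼x _ = u∼x
      ... | u∼x₂ _ x₁∼x₃ = ⊥-elim (x₁≁x₃ x₁∼x₃)
      ... | u∼x₃ _ x₁∼x₂ = ⊥-elim (x₁≁x₂ x₁∼x₂)

  private
    Matching₄-swap₁₂ : ∀ {u x₁ x₂ x₃} → Matching₄ G u x₁ x₂ x₃ → Matching₄ G u x₂ x₁ x₃
    Matching₄-swap₁₂ (u∼x₁ u∼x x₂∼x₃) = u∼x₂ u∼x x₂∼x₃
    Matching₄-swap₁₂ (u∼x₂ u∼x x₁∼x₃) = u∼x₁ u∼x x₁∼x₃
    Matching₄-swap₁₂ (u∼x₃ u∼x x₁∼x₂) = u∼x₃ u∼x (Adj-sym x₁∼x₂)

    Matching₄-rotate : ∀ {u x₁ x₂ x₃} → Matching₄ G u x₁ x₂ x₃ → Matching₄ G u x₃ x₁ x₂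
    Matching₄-rotate (u∼x₁ u∼x x₂∼x₃) = u∼x₂ u∼x (Adj-sym x₂∼x₃)
    Matching₄-rotate (u∼x₂ u∼x x₁∼x₃) = u∼x₃ u∼x (Adj-sym x₁∼x₃)
    Matching₄-rotate (u∼x₃ u∼x x₁∼x₂) = u∼x₁ u∼x x₁∼x₂

  MatchedTriple⇒shape : MatchedTriple G → SubdividedDoubleStarShape G
  MatchedTriple⇒shape X = by-edge (matched (proj₁ outsider) (proj₂ outsider))
    where
      open MatchedTriple X
      by-edge : ∀ {s} → Matching₄ G s x₁ x₂ x₃ → SubdividedDoubleStarShape G
      by-edge (u∼x₁ _ x₂∼x₃) = shape-with-edge₂₃ x₁≢x₂ x₁≢x₃ x₂≢x₃ x₂∼x₃ matched outsider
      by-edge (u∼x₂ _ x₁∼x₃) =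
        shape-with-edge₂₃ (≢-sym x₁≢x₂) x₂≢x₃ x₁≢x₃ x₁∼x₃
                          (λ u (u≢x₂ , u≢x₁ , u≢x₃) → Matching₄-swap₁₂ (matched u (u≢x₁ , u≢x₂ , u≢x₃)))
                          (map₂ (λ (u≢x₁ , u≢x₂ , u≢x₃) → u≢x₂ , u≢x₁ , u≢x₃) outsider)
      by-edge (u∼x₃ _ x₁∼x₂) =
        shape-with-edge₂₃ (≢-sym x₁≢x₃) (≢-sym x₂≢x₃) x₁≢x₂ x₁∼x₂
                          (λ u (u≢x₃ , u≢x₁ , u≢x₂) → Matching₄-rotate (matched u (u≢x₁ , u≢x₂ , u≢x₃)))
                          (map₂ (λ (u≢x₁ , u≢x₂ , u≢x₃) → u≢x₃ , u≢x₁ , u≢x₂) outsider)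

-- pc-partitions of order n − 2 in trees

avoid₂ : ∀ {k} → 3 ≤ k → (i j : Fin k) → ∃[ l ] (l ≢ i × l ≢ j)
avoid₂ (s≤s (s≤s (s≤s _))) i j with zero ≟ i | zero ≟ j
... | no 0≢i | no 0≢j = zero , 0≢i , 0≢j
... | yes refl | _ with suc zero ≟ j
...   | no 1≢j = suc zero , (λ ()) , 1≢j
...   | yes refl = suc (suc zero) , (λ ()) , (λ ())
avoid₂ (s≤s (s≤s (s≤s _))) i j | no 0≢i | yes refl with suc zero ≟ i
...   | no 1≢i = suc zero , 1≢i , (λ ())
...   | yes refl = suc (suc zero) , (λ ()) , (λ ())

module PCPartitionOfOrder-n∸2 {k : ℕ} {G : Graph (2 + k)} (simple : IsSimple G) (acyclic : Acyclic G)
  (3≤k : 3 ≤ k)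
  (f : Fin (2 + k) → Fin k) (surjective : ∀ i → ∃[ v ] (f v ≡ i))
  (partner : ∀ i → ∃[ j ] (i ≢ j × PairedDominating G (λ v → f v ≡ i ⊎ f v ≡ j))) where
  open SimpleGraph simple
  open Forest simple acyclic
  open ClassUnions simple f surjective

  two-nonReps : ∃[ r₁ ] ∃[ r₂ ] (r₁ ≢ r₂ × ¬ IsRep r₁ × ¬ IsRep r₂ × (∀ v → v ≢ r₁ → v ≢ r₂ → IsRep v))
  two-nonReps with allRep-or-nonRep
  ... | inj₁ reps = ⊥-elim (1+n≰n (m+n≤o⇒n≤o 1 (allRep⇒≤ reps)))
  ... | inj₂ (r₁ , ¬rep₁) with allRepBut-or-nonRep r₁
  ...   | inj₁ reps = ⊥-elim (1+n≰n (allRepBut⇒≤ r₁ reps))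
  ...   | inj₂ (r₂ , r₂≢r₁ , ¬rep₂) = r₁ , r₂ , ≢-sym r₂≢r₁ , ¬rep₁ , ¬rep₂ , reps
    where
      reps : ∀ v → v ≢ r₁ → v ≢ r₂ → IsRep v
      reps v v≢r₁ v≢r₂ = decidable-stable (IsRep? v) λ ¬rep →
        1+n≰n (nonReps⇒≤ (v ∷ r₁ ∷ r₂ ∷ []) ((v≢r₁ ∷ v≢r₂ ∷ []) ∷ (≢-sym r₂≢r₁ ∷ []) ∷ [] ∷ [])
                         (¬rep ∷ ¬rep₁ ∷ ¬rep₂ ∷ []))

  module _ {r₁ r₂ : Fin (2 + k)} (r₁≢r₂ : r₁ ≢ r₂) (¬rep₁ : ¬ IsRep r₁) (¬rep₂ : ¬ IsRep r₂)
           (reps : ∀ v → v ≢ r₁ → v ≢ r₂ → IsRep v) where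

    class-members : ∀ v {i} → f v ≡ i → v ≡ rep i ⊎ v ≡ r₁ ⊎ v ≡ r₂
    class-members v fv≡i with v ≟ r₁ | v ≟ r₂
    ... | yes v≡r₁ | _ = inj₂ (inj₁ v≡r₁)
    ... | no _ | yes v≡r₂ = inj₂ (inj₂ v≡r₂)
    ... | no v≢r₁ | no v≢r₂ = inj₁ (IsRep⇒≡rep (reps v v≢r₁ v≢r₂) fv≡i)

    singleton : ∀ {i} → i ≢ f r₁ → i ≢ f r₂ → IsSingleton i
    singleton i≢fr₁ i≢fr₂ v fv≡i with class-members v fv≡i
    ... | inj₁ v≡rep = v≡rep
    ... | inj₂ (inj₁ refl) = ⊥-elim (i≢fr₁ (sym fv≡i))
    ... | inj₂ (inj₂ refl) = ⊥-elim (i≢fr₂ (sym fv≡i))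

    module _ (fr₁≢fr₂ : f r₁ ≢ f r₂) where

      pair₁ : ∀ v → f v ≡ f r₁ → v ≡ rep (f r₁) ⊎ v ≡ r₁
      pair₁ v fv≡fr₁ with class-members v fv≡fr₁
      ... | inj₁ v≡rep = inj₁ v≡rep
      ... | inj₂ (inj₁ v≡r₁) = inj₂ v≡r₁
      ... | inj₂ (inj₂ refl) = ⊥-elim (fr₁≢fr₂ (sym fv≡fr₁))

      pair₂ : ∀ v → f v ≡ f r₂ → v ≡ rep (f r₂) ⊎ v ≡ r₂
      pair₂ v fv≡fr₂ with class-members v fv≡fr₂
      ... | inj₁ v≡rep = inj₁ v≡rep
      ... | inj₂ (inj₁ refl) = ⊥-elim (fr₁≢fr₂ fv≡fr₂)
      ... | inj₂ (inj₂ v≡r₂) = inj₂ v≡r₂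

      -- The partner of the pair {rep (f r₁), r₁} is a singleton, leaving three vertices without a perfect
      -- matching, or the other pair, whose matching edge at r₁ avoids all singletons.
      no-DominatingEdge-between-singletons : ∀ {i j} → i ≢ f r₁ → i ≢ f r₂ → j ≢ f r₁ → j ≢ f r₂ →
                                             ¬ DominatingEdge G (rep i) (rep j)
      no-DominatingEdge-between-singletons i≢fr₁ i≢fr₂ j≢fr₁ j≢fr₂ ij with partner (f r₁)
      ... | j′ , fr₁≢j′ , PD with j′ ≟ f r₂
      ...   | no j′≢fr₂ = pair∪singleton-¬PD ¬rep₁ pair₁ fr₁≢j′ (singleton (≢-sym fr₁≢j′) j′≢fr₂) PD
      ...   | yes refl with proj₂ PD
      ...     | m , pm with pm r₁ (inj₁ refl)
      ...       | in-pairs[mr₁] , r₁∼mr₁ , _ =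
                  no-edge-avoids-DominatingEdge ij r₁∼mr₁
                    (pairs-avoid i≢fr₁ i≢fr₂ (inj₁ refl)) (pairs-avoid j≢fr₁ j≢fr₂ (inj₁ refl))
                    (pairs-avoid i≢fr₁ i≢fr₂ in-pairs[mr₁]) (pairs-avoid j≢fr₁ j≢fr₂ in-pairs[mr₁])
        where
          pairs-avoid : ∀ {i v} → i ≢ f r₁ → i ≢ f r₂ → f v ≡ f r₁ ⊎ f v ≡ f r₂ → v ≢ rep i
          pairs-avoid {i} i≢fr₁ _ (inj₁ fv≡fr₁) refl = i≢fr₁ (trans (sym (f-rep i)) fv≡fr₁)
          pairs-avoid {i} _ i≢fr₂ (inj₂ fv≡fr₂) refl = i≢fr₂ (trans (sym (f-rep i)) fv≡fr₂)

      two-pairs-impossible : ⊥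
      two-pairs-impossible with avoid₂ 3≤k (f r₁) (f r₂)
      ... | i , i≢fr₁ , i≢fr₂ with partner i
      ... | j , i≢j , PD with j ≟ f r₁ | j ≟ f r₂
      ... | yes refl | _ =
            pair∪singleton-¬PD ¬rep₁ pair₁ (≢-sym i≢j) (singleton i≢fr₁ i≢fr₂) (PairedDominating-∪-comm PD)
      ... | no _ | yes refl =
            pair∪singleton-¬PD ¬rep₂ pair₂ (≢-sym i≢j) (singleton i≢fr₁ i≢fr₂) (PairedDominating-∪-comm PD)
      ... | no j≢fr₁ | no j≢fr₂ =
            no-DominatingEdge-between-singletons i≢fr₁ i≢fr₂ j≢fr₁ j≢fr₂
              (singleton∪singleton-DominatingEdge (singleton i≢fr₁ i≢fr₂) (singleton j≢fr₁ j≢fr₂) PD)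

    module _ (fr₁≡fr₂ : f r₁ ≡ f r₂) where

      private
        x = rep (f r₁)

        x≢r₁ : x ≢ r₁
        x≢r₁ = rep≢nonRep ¬rep₁ (f r₁)

        x≢r₂ : x ≢ r₂
        x≢r₂ = rep≢nonRep ¬rep₂ (f r₁)

        other-class-singleton : ∀ {i} → i ≢ f r₁ → IsSingleton i
        other-class-singleton i≢fr₁ = singleton i≢fr₁ (λ i≡fr₂ → i≢fr₁ (trans i≡fr₂ (sym fr₁≡fr₂)))

        other-class-outside : ∀ {i} → i ≢ f r₁ → Outside G x r₁ r₂ (rep i)
        other-class-outside i≢fr₁ = i≢fr₁ ∘ rep-injective , rep≢nonRep ¬rep₁ _ , rep≢nonRep ¬rep₂ _

        outside-class : ∀ {u} → Outside G x r₁ r₂ u → f u ≢ f r₁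
        outside-class (u≢x , u≢r₁ , u≢r₂) fu≡fr₁ with class-members _ fu≡fr₁
        ... | inj₁ u≡x = u≢x u≡x
        ... | inj₂ (inj₁ u≡r₁) = u≢r₁ u≡r₁
        ... | inj₂ (inj₂ u≡r₂) = u≢r₂ u≡r₂

        outside-rep : ∀ {u} → Outside G x r₁ r₂ u → u ≡ rep (f u)
        outside-rep u-out = other-class-singleton (outside-class u-out) _ refl

        -- The partner of the class {x, r₁, r₂} yields a perfect matching of it plus one vertex, hence an
        -- edge inside it.
        no-outside-DominatingEdge : ∀ {u w} → DominatingEdge G u w →
                                    Outside G x r₁ r₂ u → Outside G x r₁ r₂ w → ⊥
        no-outside-DominatingEdge uw u-out w-out with partner (f r₁)
        ... | j , fr₁≢j , PD =
              DominatingEdge-¬Matching₄ uw u-out w-out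
                (HasPM⇒Matching₄ x≢r₁ x≢r₂ (other-class-outside (≢-sym fr₁≢j))
                                 (inj₂ (f-rep j)) (inj₁ (f-rep (f r₁))) (inj₁ refl) only (proj₂ PD))
          where
            only : ∀ v → f v ≡ f r₁ ⊎ f v ≡ j → v ≡ rep j ⊎ v ≡ x ⊎ v ≡ r₁ ⊎ v ≡ r₂
            only v (inj₁ fv≡fr₁) = inj₂ (class-members v fv≡fr₁)
            only v (inj₂ fv≡j) = inj₁ (other-class-singleton (≢-sym fr₁≢j) v fv≡j)

        matched : ∀ u → Outside G x r₁ r₂ u → Matching₄ G u x r₁ r₂
        matched u u-out with partner (f u)
        ... | j , _ , PD with j ≟ f r₁
        ... | yes refl =
              HasPM⇒Matching₄ x≢r₁ x≢r₂ u-out (inj₁ refl) (inj₂ (f-rep (f r₁))) (inj₂ refl) only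
                              (proj₂ PD)
          where
            only : ∀ v → f v ≡ f u ⊎ f v ≡ f r₁ → v ≡ u ⊎ v ≡ x ⊎ v ≡ r₁ ⊎ v ≡ r₂
            only v (inj₁ fv≡fu) =
              inj₁ (trans (other-class-singleton (outside-class u-out) v fv≡fu) (sym (outside-rep u-out)))
            only v (inj₂ fv≡fr₁) = inj₂ (class-members v fv≡fr₁)
        ... | no j≢fr₁ =
              ⊥-elim (no-outside-DominatingEdge
                        (subst (λ u′ → DominatingEdge G u′ (rep j)) (sym (outside-rep u-out))
                               (singleton∪singleton-DominatingEdge (other-class-singleton (outside-class u-out))
                                                                   (other-class-singleton j≢fr₁) PD))
                        u-out (other-class-outside j≢fr₁))

      triple : MatchedTriple G
      triple with avoid₂ 3≤k (f r₁) (f r₂)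
      ... | i , i≢fr₁ , _ = record
        { x₁ = x ; x₂ = r₁ ; x₃ = r₂ ; x₁≢x₂ = x≢r₁ ; x₁≢x₃ = x≢r₂ ; x₂≢x₃ = r₁≢r₂
        ; outsider = rep i , other-class-outside i≢fr₁
        ; matched = matched }

  matchedTriple : MatchedTriple G
  matchedTriple with two-nonReps
  ... | r₁ , r₂ , r₁≢r₂ , ¬rep₁ , ¬rep₂ , reps with f r₁ ≟ f r₂
  ...   | yes fr₁≡fr₂ = triple r₁≢r₂ ¬rep₁ ¬rep₂ reps fr₁≡fr₂
  ...   | no fr₁≢fr₂ = ⊥-elim (two-pairs-impossible r₁≢r₂ ¬rep₁ ¬rep₂ reps fr₁≢fr₂)

PCis⇒IsSubdividedDoubleStar : ∀ n (T : Graph n) → 5 ≤ n → IsTree T → PCis T (n ∸ 2) →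
                              IsSubdividedDoubleStar T
PCis⇒IsSubdividedDoubleStar (suc (suc k)) T (s≤s (s≤s 3≤k)) _ (inj₁ (k≡0 , _))
  with () ← subst (3 ≤_) k≡0 3≤k
PCis⇒IsSubdividedDoubleStar (suc (suc k)) T (s≤s (s≤s 3≤k)) (simple , connected , acyclic)
                            (inj₂ ((f , surjective , _ , partner) , _)) =
  FromShape.isSubdividedDoubleStar simple acyclic
    (TreeShape.MatchedTriple⇒shape simple acyclic connected
      (PCPartitionOfOrder-n∸2.matchedTriple simple acyclic 3≤k f surjective partner))

IsSubdividedDoubleStar⇒PCis : ∀ n (T : Graph n) → IsSubdividedDoubleStar T → PCis T (n ∸ 2)
IsSubdividedDoubleStar⇒PCis n T (p , suc q , _ , T≅H) with ↔⇒≡ (proj₁ T≅H)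
... | refl = PCis-pullback T≅H (SubdividedDoubleStar-PCis p q)

IsSubdividedDoubleStar⇒cases : ∀ {n} {T : Graph n} → IsSubdividedDoubleStar T →
  (∃[ p ] (1 ≤ p × T ≅ DoubleStar 1 p)) ⊎ (∃[ p ] ∃[ q ] (1 ≤ p × 1 ≤ q × T ≅ SubdividedDoubleStar p q))
IsSubdividedDoubleStar⇒cases (zero , q , 1≤q , T≅H) =
  inj₁ (q , 1≤q , ≅-trans {H = SubdividedDoubleStar 0 q} {K = DoubleStar 1 q} T≅H
                          (SubdividedDoubleStar₀≅DoubleStar₁ q))
IsSubdividedDoubleStar⇒cases (suc p , q , 1≤q , T≅H) = inj₂ (suc p , q , s≤s z≤n , 1≤q , T≅H)

cases⇒IsSubdividedDoubleStar : ∀ {n} {T : Graph n} →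
  (∃[ p ] (1 ≤ p × T ≅ DoubleStar 1 p)) ⊎ (∃[ p ] ∃[ q ] (1 ≤ p × 1 ≤ q × T ≅ SubdividedDoubleStar p q)) →
  IsSubdividedDoubleStar T
cases⇒IsSubdividedDoubleStar (inj₁ (p , 1≤p , T≅H)) =
  0 , p , 1≤p , ≅-trans {H = DoubleStar 1 p} {K = SubdividedDoubleStar 0 p} T≅H
                        (≅-sym (SubdividedDoubleStar₀≅DoubleStar₁ p))
cases⇒IsSubdividedDoubleStar (inj₂ (p , q , _ , 1≤q , T≅H)) = p , q , 1≤q , T≅H

mainTheorem8 : ∀ (n : ℕ) (T : Graph n) → 5 ≤ n → IsTree T →
    (PCis T (n ∸ 2) ⇔
      ((∃[ p ] (1 ≤ p × T ≅ DoubleStar 1 p))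
       ⊎ (∃[ p ] ∃[ q ] (1 ≤ p × 1 ≤ q × T ≅ SubdividedDoubleStar p q))))
mainTheorem8 n T 5≤n tree =
  mk⇔ (IsSubdividedDoubleStar⇒cases ∘ PCis⇒IsSubdividedDoubleStar n T 5≤n tree)
      (IsSubdividedDoubleStar⇒PCis n T ∘ cases⇒IsSubdividedDoubleStar)
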